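{- Let $\mathcal{C}$ be a cartesian monoidal category (monoidal product the binary product $\times$, unit a terminal object $1$), and let $X,Y$ be $\mathbb{N}$-indexed families of objects of $\mathcal{C}$. Then for every $n\in\mathbb{N}$, $$\mathrm{Comb}^{+}_n(X,Y)\cong\mathrm{Comb}_n(X,Y)\cong\prod_{i=0}^{n}\mathcal{C}(X_0\times\dots\times X_i,\,Y_i).$$
   Context: For families $X,Y$ of objects of $\mathcal{C}$ indexed by $\mathbb{N}$, define the coends in sets $$\mathrm{Comb}_n(X,Y)=\int^{M_0,\dots,M_{n-1}\in\mathcal{C}}\prod_{i=0}^{n}\mathcal{C}(M_{i-1}\times X_i,\,M_i\times Y_i),\quad M_{ -1}=M_n:=1,$$ $$\mathrm{Comb}_n^{+}(X,Y)=\int^{M_0,\dots,M_n\in\mathcal{C}}\prod_{i=0}^{n}\mathcal{C}(M_{i-1}\times X_i,\,M_i\times Y_i),\quad M_{ -1}:=1.$$ -}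

module Defs where

open import Level using (Level; _⊔_) renaming (suc to lsuc)
open import Data.Nat using (ℕ; zero; suc)
open import Data.Fin using (Fin; zero; suc; inject₁; toℕ)
open import Data.Product using (Σ; _,_)
open import Relation.Binary using (Rel; Setoid; IsEquivalence)
import Relation.Binary.Construct.Closure.Equivalence as EqClosure

record Category (o ℓ e : Level) : Set (lsuc (o ⊔ ℓ ⊔ e)) where
  infix  4 _≈_ _⇒_
  infixr 9 _∘_
  field
    Obj : Set o
    _⇒_ : Obj → Obj → Set ℓ
    _≈_ : ∀ {A B} → Rel (A ⇒ B) e
    ≈-equiv : ∀ {A B} → IsEquivalence (_≈_ {A} {B})
    id  : ∀ {A} → A ⇒ A
    _∘_ : ∀ {A B C} → B ⇒ C → A ⇒ B → A ⇒ C
    assoc : ∀ {A B C D} {f : A ⇒ B} {g : B ⇒ C} {h : C ⇒ D} →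
            (h ∘ g) ∘ f ≈ h ∘ (g ∘ f)
    identityˡ : ∀ {A B} {f : A ⇒ B} → id ∘ f ≈ f
    identityʳ : ∀ {A B} {f : A ⇒ B} → f ∘ id ≈ f
    ∘-resp-≈ : ∀ {A B C} {f h : B ⇒ C} {g i : A ⇒ B} →
               f ≈ h → g ≈ i → f ∘ g ≈ h ∘ i

record CartesianCategory (o ℓ e : Level) : Set (lsuc (o ⊔ ℓ ⊔ e)) where
  field
    category : Category o ℓ e
  open Category category public
  infixr 7 _×_
  field
    𝟙 : Obj
    ! : ∀ {A} → A ⇒ 𝟙
    !-unique : ∀ {A} (f : A ⇒ 𝟙) → f ≈ !
    _×_ : Obj → Obj → Obj
    π₁ : ∀ {A B} → A × B ⇒ A
    π₂ : ∀ {A B} → A × B ⇒ B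
    ⟨_,_⟩ : ∀ {A B C} → C ⇒ A → C ⇒ B → C ⇒ A × B
    project₁ : ∀ {A B C} {f : C ⇒ A} {g : C ⇒ B} → π₁ ∘ ⟨ f , g ⟩ ≈ f
    project₂ : ∀ {A B C} {f : C ⇒ A} {g : C ⇒ B} → π₂ ∘ ⟨ f , g ⟩ ≈ g
    unique : ∀ {A B C} {h : C ⇒ A × B} {f : C ⇒ A} {g : C ⇒ B} →
             π₁ ∘ h ≈ f → π₂ ∘ h ≈ g → ⟨ f , g ⟩ ≈ h

  _⁂_ : ∀ {A B C D} → A ⇒ B → C ⇒ D → A × C ⇒ B × D
  f ⁂ g = ⟨ f ∘ π₁ , g ∘ π₂ ⟩

module Combs {o ℓ e : Level} (CC : CartesianCategory o ℓ e)
             (X Y : ℕ → CartesianCategory.Obj CC) where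
  open CartesianCategory CC

  -- Generic coend (in setoids) of  ∏_{i=0}^{n} C(E_{i} × X_i , E_{i+1} × Y_i)
  -- over a tuple M : Fin k → Obj, where E = ext M : Fin (n+2) → Obj is the
  -- extended chain of objects (with the boundary objects being 1).
  module Generic (n k : ℕ)
    (ext : (Fin k → Obj) → Fin (suc (suc n)) → Obj)
    (extH : ∀ {M N : Fin k → Obj} → (∀ j → M j ⇒ N j) →
            ∀ p → ext M p ⇒ ext N p) where

    Comps : (Fin k → Obj) → (Fin k → Obj) → Set ℓ
    Comps N M = ∀ (i : Fin (suc n)) →
      (ext N (inject₁ i) × X (toℕ i)) ⇒ (ext M (suc i) × Y (toℕ i))

    Elem : Set (o ⊔ ℓ)
    Elem = Σ (Fin k → Obj) λ M → Comps M M

    data Step : Elem → Elem → Set (o ⊔ ℓ ⊔ e) where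
      ≈-step : ∀ {M} {f g : Comps M M} → (∀ i → f i ≈ g i) →
               Step (M , f) (M , g)
      dinat  : ∀ {M N} (h : ∀ j → M j ⇒ N j) (f : Comps N M) →
               Step (M , λ i → f i ∘ (extH h (inject₁ i) ⁂ id))
                    (N , λ i → (extH h (suc i) ⁂ id) ∘ f i)

    CoendSetoid : Setoid (o ⊔ ℓ) (o ⊔ ℓ ⊔ e)
    CoendSetoid = EqClosure.setoid Step

  -- extension for Comb_n : M_0..M_{n-1}, with M_{-1} = M_n = 1
  snoc1 : ∀ {n} → (Fin n → Obj) → Fin (suc n) → Obj
  snoc1 {zero}  M zero    = 𝟙
  snoc1 {suc n} M zero    = M zero
  snoc1 {suc n} M (suc p) = snoc1 (λ j → M (suc j)) p

  snoc1H : ∀ {n} {M N : Fin n → Obj} → (∀ j → M j ⇒ N j) →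
           ∀ p → snoc1 M p ⇒ snoc1 N p
  snoc1H {zero}  h zero    = id
  snoc1H {suc n} h zero    = h zero
  snoc1H {suc n} h (suc p) = snoc1H (λ j → h (suc j)) p

  extC : ∀ {n} → (Fin n → Obj) → Fin (suc (suc n)) → Obj
  extC M zero    = 𝟙
  extC M (suc p) = snoc1 M p

  extCH : ∀ {n} {M N : Fin n → Obj} → (∀ j → M j ⇒ N j) →
          ∀ p → extC M p ⇒ extC N p
  extCH h zero    = id
  extCH h (suc p) = snoc1H h p

  -- extension for Comb⁺_n : M_0..M_n, with M_{-1} = 1
  extP : ∀ {n} → (Fin (suc n) → Obj) → Fin (suc (suc n)) → Obj
  extP M zero    = 𝟙
  extP M (suc p) = M p

  extPH : ∀ {n} {M N : Fin (suc n) → Obj} → (∀ j → M j ⇒ N j) →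
          ∀ p → extP M p ⇒ extP N p
  extPH h zero    = id
  extPH h (suc p) = h p

  Comb : ℕ → Setoid (o ⊔ ℓ) (o ⊔ ℓ ⊔ e)
  Comb n = Generic.CoendSetoid n n extC extCH

  Comb⁺ : ℕ → Setoid (o ⊔ ℓ) (o ⊔ ℓ ⊔ e)
  Comb⁺ n = Generic.CoendSetoid n (suc n) extP extPH

  Xs : ℕ → Obj
  Xs zero    = X zero
  Xs (suc i) = Xs i × X (suc i)

  Prod : ℕ → Setoid ℓ e
  Prod n = record
    { Carrier = ∀ (i : Fin (suc n)) → Xs (toℕ i) ⇒ Y (toℕ i)
    ; _≈_ = λ f g → ∀ i → f i ≈ g i
    ; isEquivalence = record
      { refl  = λ i → IsEquivalence.refl ≈-equiv
      ; sym   = λ p i → IsEquivalence.sym ≈-equiv (p i)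
      ; trans = λ p q i → IsEquivalence.trans ≈-equiv (p i) (q i) } }

module Submission where

-- An element of Comb⁺ₙ is represented by a chain of objects M₀,…,Mₙ (with
-- M₋₁ = 1) and components Gᵢ : Mᵢ₋₁ × Xᵢ → Mᵢ × Yᵢ.  Running the comb on
-- inputs x₀,…,xᵢ produces a state stateᵢ : X₀×⋯×Xᵢ → Mᵢ and an output
-- outputᵢ : X₀×⋯×Xᵢ → Yᵢ.  A morphism of chains commuting with the
-- components transports states and preserves outputs; both generators of
-- the coend relation are such morphisms, so `output` descends to Comb⁺ₙ.
-- Its inverse sends p to the canonical comb, whose chain is Mᵢ = X₀×⋯×Xᵢ.
-- To identify an arbitrary comb with the canonical comb of its outputs we
-- unfold it (replace Mᵢ by Mᵢ₋₁ × Xᵢ); an unfolding is coend-equivalent to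
-- the original, and after n+1 unfoldings every state is an isomorphism, at
-- which point a single dinaturality step reaches the canonical comb.
-- Separately, Combₙ ≅ Comb⁺ₙ because the last object Mₙ can be collapsed
-- to 1.  The theorem composes these two isomorphisms.

open import Defs
open import Level using (_⊔_)
open import Data.Nat using (ℕ; zero; suc; _<_; s≤s)
open import Data.Fin using (Fin; zero; suc; inject₁; toℕ)
open import Data.Fin.Properties using (toℕ-inject₁; toℕ<n)
open import Data.Product using (Σ; _,_; proj₁; proj₂) renaming (_×_ to _∧_)
open import Function.Bundles using (Inverse)
open import Function.Consequences.Setoid
  using (strictlyInverseˡ⇒inverseˡ; strictlyInverseʳ⇒inverseʳ)
import Function.Construct.Composition as Composition
import Function.Construct.Symmetry as Symmetry
open import Relation.Binary using (Setoid; IsEquivalence)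
open import Relation.Binary.PropositionalEquality as ≡ using (_≡_; refl)
import Relation.Binary.Construct.Closure.Equivalence as EqClosure
open import Relation.Binary.Construct.Closure.ReflexiveTransitive
  using (ε; _◅_; _◅◅_)
open import Relation.Binary.Construct.Closure.Symmetric using (fwd)

finRec : ∀ {a n} (P : Fin (suc n) → Set a) → P zero →
         (∀ j → P (inject₁ j) → P (suc j)) → ∀ i → P i
finRec P z s zero = z
finRec {n = suc n} P z s (suc j) =
  s j (finRec (λ i → P (inject₁ i)) z (λ j′ → s (inject₁ j′)) j)

finRec-restrict : ∀ {a n} (P : Fin (suc (suc n)) → Set a) (z : P zero)
  (s : ∀ j → P (inject₁ j) → P (suc j)) (j : Fin (suc n)) →
  finRec (λ i → P (inject₁ i)) z (λ j′ → s (inject₁ j′)) j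
    ≡ finRec P z s (inject₁ j)
finRec-restrict P z s zero = refl
finRec-restrict {n = suc n} P z s (suc j) =
  ≡.cong (s (inject₁ j))
         (finRec-restrict (λ i → P (inject₁ i)) z (λ j′ → s (inject₁ j′)) j)

finRec-suc : ∀ {a n} (P : Fin (suc n) → Set a) (z : P zero)
  (s : ∀ j → P (inject₁ j) → P (suc j)) (j : Fin n) →
  finRec P z s (suc j) ≡ s j (finRec P z s (inject₁ j))
finRec-suc {n = suc n} P z s j = ≡.cong (s j) (finRec-restrict P z s j)

module CartesianReasoning {o ℓ e} (CC : CartesianCategory o ℓ e) where
  open CartesianCategory CC public
  private module E {A B : Obj} = IsEquivalence (≈-equiv {A} {B})

  ≈refl : ∀ {A B} {f : A ⇒ B} → f ≈ f
  ≈refl = E.refl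

  ≈sym : ∀ {A B} {f g : A ⇒ B} → f ≈ g → g ≈ f
  ≈sym = E.sym

  infixr 3 _■_
  _■_ : ∀ {A B} {f g h : A ⇒ B} → f ≈ g → g ≈ h → f ≈ h
  _■_ = E.trans

  ≡⇒≈ : ∀ {A B} {f g : A ⇒ B} → f ≡ g → f ≈ g
  ≡⇒≈ refl = ≈refl

  reflˡ : ∀ {A B C} {f : B ⇒ C} {g i : A ⇒ B} → g ≈ i → f ∘ g ≈ f ∘ i
  reflˡ p = ∘-resp-≈ ≈refl p

  reflʳ : ∀ {A B C} {f h : B ⇒ C} {g : A ⇒ B} → f ≈ h → f ∘ g ≈ h ∘ g
  reflʳ p = ∘-resp-≈ p ≈refl

  sassoc : ∀ {A B C D} {f : A ⇒ B} {g : B ⇒ C} {h : C ⇒ D} →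
           h ∘ (g ∘ f) ≈ (h ∘ g) ∘ f
  sassoc = ≈sym assoc

  !-uniq : ∀ {A} (f g : A ⇒ 𝟙) → f ≈ g
  !-uniq f g = !-unique f ■ ≈sym (!-unique g)

  ⟨⟩-cong : ∀ {A B C} {f f′ : C ⇒ A} {g g′ : C ⇒ B} →
            f ≈ f′ → g ≈ g′ → ⟨ f , g ⟩ ≈ ⟨ f′ , g′ ⟩
  ⟨⟩-cong p q = unique (project₁ ■ ≈sym p) (project₂ ■ ≈sym q)

  η : ∀ {A B C} {h : C ⇒ A × B} → ⟨ π₁ ∘ h , π₂ ∘ h ⟩ ≈ h
  η = unique ≈refl ≈refl

  ⟨π₁,π₂⟩≈id : ∀ {A B} → ⟨ π₁ {A} {B} , π₂ ⟩ ≈ id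
  ⟨π₁,π₂⟩≈id = unique identityʳ identityʳ

  ⟨⟩∘ : ∀ {A B C D} {f : C ⇒ A} {g : C ⇒ B} {h : D ⇒ C} →
        ⟨ f , g ⟩ ∘ h ≈ ⟨ f ∘ h , g ∘ h ⟩
  ⟨⟩∘ = ≈sym (unique (sassoc ■ reflʳ project₁) (sassoc ■ reflʳ project₂))

  ⁂∘⟨⟩ : ∀ {A B C D E} {f : A ⇒ B} {g : C ⇒ D} {a : E ⇒ A} {b : E ⇒ C} →
         (f ⁂ g) ∘ ⟨ a , b ⟩ ≈ ⟨ f ∘ a , g ∘ b ⟩
  ⁂∘⟨⟩ = ⟨⟩∘ ■ ⟨⟩-cong (assoc ■ reflˡ project₁) (assoc ■ reflˡ project₂)

  ⁂-cong : ∀ {A B C D} {f f′ : A ⇒ B} {g g′ : C ⇒ D} →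
           f ≈ f′ → g ≈ g′ → (f ⁂ g) ≈ (f′ ⁂ g′)
  ⁂-cong p q = ⟨⟩-cong (reflʳ p) (reflʳ q)

  id⁂id : ∀ {A B} → (id {A} ⁂ id {B}) ≈ id
  id⁂id = unique (identityʳ ■ ≈sym identityˡ) (identityʳ ■ ≈sym identityˡ)

  ⁂id-cong : ∀ {A B C} {f f′ : A ⇒ B} → f ≈ f′ → (f ⁂ id {C}) ≈ (f′ ⁂ id)
  ⁂id-cong p = ⁂-cong p ≈refl

  ⁂id∘ : ∀ {A B C D} {f : B ⇒ C} {g : A ⇒ B} →
         (f ⁂ id {D}) ∘ (g ⁂ id) ≈ (f ∘ g) ⁂ id
  ⁂id∘ = ⁂∘⟨⟩ ■ ⟨⟩-cong sassoc (sassoc ■ reflʳ identityˡ)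

  cancel⁂id : ∀ {A B C D} {g : B × D ⇒ C} {a : A ⇒ B} {b : B ⇒ A} →
              a ∘ b ≈ id → (g ∘ (a ⁂ id)) ∘ (b ⁂ id) ≈ g
  cancel⁂id p = assoc ■ reflˡ (⁂id∘ ■ ⁂id-cong p ■ id⁂id) ■ identityʳ

  -- 1 × A ≅ A via π₂ and ⟨ ! , id ⟩ (the other composite is project₂).
  ⟨!,id⟩∘π₂ : ∀ {A} → ⟨ ! , id ⟩ ∘ π₂ ≈ id {𝟙 × A}
  ⟨!,id⟩∘π₂ = ⟨⟩∘ ■ ⟨⟩-cong (!-uniq _ _) identityˡ ■ ⟨π₁,π₂⟩≈id

  inverse-∘ : ∀ {A B C} {a : A ⇒ B} {b : B ⇒ A} {c : B ⇒ C} {d : C ⇒ B} →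
              a ∘ b ≈ id → c ∘ d ≈ id → (c ∘ a) ∘ (b ∘ d) ≈ id
  inverse-∘ p q = assoc ■ reflˡ sassoc ■ reflˡ (reflʳ p ■ identityˡ) ■ q

  IsInverse : ∀ {A B} → A ⇒ B → B ⇒ A → Set e
  IsInverse f g = (g ∘ f ≈ id) ∧ (f ∘ g ≈ id)

  IsInverse-resp : ∀ {A B} {s s′ : A ⇒ B} {g : B ⇒ A} →
                   s ≈ s′ → IsInverse s′ g → IsInverse s g
  IsInverse-resp q (gs , sg) = (reflˡ q ■ gs) , (reflʳ q ■ sg)

module CoendFacts {o ℓ e} (CC : CartesianCategory o ℓ e)
                  (X Y : ℕ → CartesianCategory.Obj CC) (n k : ℕ)
  (ext : (Fin k → CartesianCategory.Obj CC) →
         Fin (suc (suc n)) → CartesianCategory.Obj CC)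
  (extH : ∀ {M N} → (∀ j → CartesianCategory._⇒_ CC (M j) (N j)) →
          ∀ p → CartesianCategory._⇒_ CC (ext M p) (ext N p)) where
  open CartesianReasoning CC
  open Combs CC X Y
  open Generic n k ext extH public

  infix 4 _~_
  _~_ : Elem → Elem → Set (o ⊔ ℓ ⊔ e)
  _~_ = Setoid._≈_ CoendSetoid

  ~-sym : ∀ {x y} → x ~ y → y ~ x
  ~-sym = EqClosure.symmetric Step

  ≈-elem : ∀ {M} {f g : Comps M M} → (∀ i → f i ≈ g i) → (M , f) ~ (M , g)
  ≈-elem p = fwd (≈-step p) ◅ ε

  dinat≈ : ∀ {M N} (h : ∀ j → M j ⇒ N j) (f : Comps N M)
           {F : Comps M M} {G : Comps N N} →
           (∀ i → F i ≈ f i ∘ (extH h (inject₁ i) ⁂ id)) →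
           (∀ i → (extH h (suc i) ⁂ id) ∘ f i ≈ G i) →
           (M , F) ~ (N , G)
  dinat≈ h f l r = ≈-elem l ◅◅ (fwd (dinat h f) ◅ ≈-elem r)

-- Comb⁺ₙ ≅ ∏ᵢ C(X₀ × ⋯ × Xᵢ , Yᵢ).
module Outputs {o ℓ e} (CC : CartesianCategory o ℓ e)
               (X Y : ℕ → CartesianCategory.Obj CC) (n : ℕ) where
  open CartesianReasoning CC
  open Combs CC X Y
  open CoendFacts CC X Y n (suc n) extP extPH

  Chain : Set o
  Chain = Fin (suc n) → Obj

  -- The memory object Mᵢ₋₁ entering the i-th component.
  prev : Chain → Fin (suc n) → Obj
  prev M i = extP M (inject₁ i)

  castXs : ∀ {a b} → a ≡ b → Xs a ⇒ Xs b
  castXs refl = id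

  castXs-inverse : ∀ {a b} (p : a ≡ b) → IsInverse (castXs (≡.sym p)) (castXs p)
  castXs-inverse refl = identityˡ , identityˡ

  -- Xs (toℕ j) ≅ Xs (toℕ (inject₁ j)), needed to feed the state at inject₁ j
  -- into the component at suc j.
  toInj : (j : Fin n) → Xs (toℕ j) ⇒ Xs (toℕ (inject₁ j))
  toInj j = castXs (≡.sym (toℕ-inject₁ j))

  fromInj : (j : Fin n) → Xs (toℕ (inject₁ j)) ⇒ Xs (toℕ j)
  fromInj j = castXs (toℕ-inject₁ j)

  toInj-inverse : ∀ j → IsInverse (toInj j) (fromInj j)
  toInj-inverse j = castXs-inverse (toℕ-inject₁ j)

  module Run (M : Chain) (G : Comps M M) where
    State : Fin (suc n) → Set ℓ
    State i = Xs (toℕ i) ⇒ M i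

    nextState : ∀ j → State (inject₁ j) → State (suc j)
    nextState j s = π₁ ∘ G (suc j) ∘ ((s ∘ toInj j) ⁂ id)

    state : ∀ i → State i
    state = finRec State (π₁ ∘ G zero ∘ ⟨ ! , id ⟩) nextState

    input : ∀ i → Xs (toℕ i) ⇒ prev M i × X (toℕ i)
    input zero    = ⟨ ! , id ⟩
    input (suc j) = (state (inject₁ j) ∘ toInj j) ⁂ id

    state-eq : ∀ i → state i ≈ π₁ ∘ G i ∘ input i
    state-eq zero    = ≈refl
    state-eq (suc j) = ≡⇒≈ (finRec-suc State _ nextState j)

    output : ∀ i → Xs (toℕ i) ⇒ Y (toℕ i)
    output i = π₂ ∘ G i ∘ input i

  outputs : Elem → Setoid.Carrier (Prod n)
  outputs (M , G) = Run.output M G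

  -- A morphism of combs h : (M₁,G₁) → (M₂,G₂) (a chain map commuting with
  -- the components) satisfies state₂ ≈ h ∘ state₁, hence preserves outputs.
  module Morphism (M₁ : Chain) (G₁ : Comps M₁ M₁) (M₂ : Chain) (G₂ : Comps M₂ M₂)
    (h : ∀ i → M₁ i ⇒ M₂ i)
    (commutes : ∀ i → G₂ i ∘ (extPH h (inject₁ i) ⁂ id) ≈ (h i ⁂ id) ∘ G₁ i) where
    module R₁ = Run M₁ G₁
    module R₂ = Run M₂ G₂

    InputsRelated : Fin (suc n) → Set e
    InputsRelated i = R₂.input i ≈ (extPH h (inject₁ i) ⁂ id) ∘ R₁.input i

    component : ∀ i → InputsRelated i →
                G₂ i ∘ R₂.input i ≈ (h i ⁂ id) ∘ (G₁ i ∘ R₁.input i)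
    component i q = reflˡ q ■ sassoc ■ reflʳ (commutes i) ■ assoc

    input-zero : InputsRelated zero
    input-zero = ≈sym (reflʳ id⁂id ■ identityˡ)

    input-suc : ∀ j → R₂.state (inject₁ j) ≈ h (inject₁ j) ∘ R₁.state (inject₁ j) →
                InputsRelated (suc j)
    input-suc j p = ⁂id-cong (reflʳ p ■ assoc) ■ ≈sym ⁂id∘

    state-from-input : ∀ i → InputsRelated i → R₂.state i ≈ h i ∘ R₁.state i
    state-from-input i q = R₂.state-eq i ■ reflˡ (component i q) ■ sassoc
      ■ reflʳ project₁ ■ assoc ■ reflˡ (≈sym (R₁.state-eq i))

    state-natural : ∀ i → R₂.state i ≈ h i ∘ R₁.state i
    state-natural = finRec (λ i → R₂.state i ≈ h i ∘ R₁.state i)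
      (state-from-input zero input-zero)
      (λ j p → state-from-input (suc j) (input-suc j p))

    inputs-related : ∀ i → InputsRelated i
    inputs-related zero    = input-zero
    inputs-related (suc j) = input-suc j (state-natural (inject₁ j))

    output-preserved : ∀ i → R₂.output i ≈ R₁.output i
    output-preserved i = reflˡ (component i (inputs-related i)) ■ sassoc
      ■ reflʳ project₂ ■ assoc ■ identityˡ

  -- Both generators of the coend relation are morphisms of combs.
  outputs-step : ∀ {x y} → Step x y → Setoid._≈_ (Prod n) (outputs x) (outputs y)
  outputs-step (≈-step {M} {f} {g} p) =
    λ i → ≈sym (Morphism.output-preserved M f M g (λ _ → id) commutes i)
    where
      extPH-id : ∀ p → extPH (λ j → id {M j}) p ≈ id
      extPH-id zero    = ≈refl
      extPH-id (suc p) = ≈refl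
      commutes : ∀ i → g i ∘ (extPH (λ _ → id) (inject₁ i) ⁂ id) ≈ (id ⁂ id) ∘ f i
      commutes i = reflˡ (⁂id-cong (extPH-id (inject₁ i)) ■ id⁂id) ■ identityʳ
        ■ ≈sym (p i) ■ ≈sym (reflʳ id⁂id ■ identityˡ)
  -- For dinat, commutation is associativity: both sides are
  -- (hᵢ ⁂ id) ∘ fᵢ ∘ (hᵢ₋₁ ⁂ id).
  outputs-step (dinat {M} {N} h f) =
    λ i → ≈sym (Morphism.output-preserved M _ N _ h (λ i → assoc) i)

  outputs-cong : ∀ {x y} → x ~ y → Setoid._≈_ (Prod n) (outputs x) (outputs y)
  outputs-cong = EqClosure.gfold (Setoid.isEquivalence (Prod n)) outputs outputs-step

  -- The canonical comb of p: the memory is the whole input history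
  -- X₀ × ⋯ × Xᵢ, and the i-th component appends xᵢ and outputs pᵢ.
  History : Chain
  History i = Xs (toℕ i)

  append : ∀ i → prev History i × X (toℕ i) ⇒ Xs (toℕ i)
  append zero    = π₂
  append (suc j) = fromInj j ⁂ id

  canonical : Setoid.Carrier (Prod n) → Elem
  canonical p = History , λ i → ⟨ append i , p i ∘ append i ⟩

  canonical-cong : ∀ {p q} → Setoid._≈_ (Prod n) p q → canonical p ~ canonical q
  canonical-cong pq = ≈-elem (λ i → ⟨⟩-cong ≈refl (reflʳ (pq i)))

  -- The states of a canonical comb are identities, so its outputs are p.
  module RunCanonical (p : Setoid.Carrier (Prod n)) where
    open Run History (proj₂ (canonical p))

    append-zero : append zero ∘ input zero ≈ id
    append-zero = project₂

    append-suc : ∀ j → state (inject₁ j) ≈ id → append (suc j) ∘ input (suc j) ≈ id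
    append-suc j q = ⁂id∘ ■ ⁂id-cong (reflˡ (reflʳ q ■ identityˡ)
      ■ proj₁ (toInj-inverse j)) ■ id⁂id

    state-from-append : ∀ i → append i ∘ input i ≈ id → state i ≈ id
    state-from-append i q = state-eq i ■ sassoc ■ reflʳ project₁ ■ q

    state-id : ∀ i → state i ≈ id
    state-id = finRec (λ i → state i ≈ id) (state-from-append zero append-zero)
      (λ j q → state-from-append (suc j) (append-suc j q))

    append-input : ∀ i → append i ∘ input i ≈ id
    append-input zero    = append-zero
    append-input (suc j) = append-suc j (state-id (inject₁ j))

    outputs-canonical : ∀ i → output i ≈ p i
    outputs-canonical i = sassoc ■ reflʳ project₂ ■ assoc
      ■ reflˡ (append-input i) ■ identityʳ

  -- The unfolding of a comb: memory Mᵢ₋₁ × Xᵢ, i.e. the comb postpones the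
  -- application of π₁ ∘ Gᵢ to the next step.
  unfold : Elem → Elem
  unfold (M , G) = (λ i → prev M i × X (toℕ i)) ,
                   λ i → ⟨ id , π₂ ∘ G i ⟩ ∘ (extPH (λ i → π₁ ∘ G i) (inject₁ i) ⁂ id)

  refold : ∀ {M} (G : Comps M M) i → ((π₁ ∘ G i) ⁂ id) ∘ ⟨ id , π₂ ∘ G i ⟩ ≈ G i
  refold G i = ⁂∘⟨⟩ ■ ⟨⟩-cong identityʳ identityˡ ■ η

  unfold~ : ∀ x → unfold x ~ x
  unfold~ (M , G) = dinat≈ (λ i → π₁ ∘ G i) (λ i → ⟨ id , π₂ ∘ G i ⟩)
                           (λ i → ≈refl) (refold G)

  StateIso : Elem → Fin (suc n) → Set (ℓ ⊔ e)
  StateIso (M , G) i = Σ (M i ⇒ Xs (toℕ i)) (IsInverse (state i))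
    where open Run M G

  -- Unfolding makes the first state invertible and shifts invertibility of
  -- the j-th state to the (j+1)-th.
  module Unfold (x : Elem) where
    M : Chain
    M = proj₁ x

    G : Comps M M
    G = proj₂ x

    open Run M G
    module U = Run (proj₁ (unfold x)) (proj₂ (unfold x))
    -- π₁ ∘ Gᵢ is a morphism from the unfolding back to (M,G).
    module Refold = Morphism _ _ M G (λ i → π₁ ∘ G i)
      (λ i → ≈sym (sassoc ■ reflʳ (refold G i)))

    state-zero : U.state zero ≈ ⟨ ! , id ⟩
    state-zero = sassoc ■ reflʳ (sassoc ■ reflʳ project₁ ■ identityˡ ■ id⁂id)
      ■ identityˡ

    iso-zero : StateIso (unfold x) zero
    iso-zero = π₂ , IsInverse-resp state-zero (project₂ , ⟨!,id⟩∘π₂)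

    state-suc : ∀ j → U.state (suc j) ≈ (state (inject₁ j) ∘ toInj j) ⁂ id
    state-suc j = U.state-eq (suc j) ■ sassoc
      ■ reflʳ (sassoc ■ reflʳ project₁ ■ identityˡ) ■ ⁂id∘
      ■ ⁂id-cong (sassoc ■ reflʳ (≈sym (Refold.state-natural (inject₁ j))))

    iso-suc : ∀ j → StateIso x (inject₁ j) → StateIso (unfold x) (suc j)
    iso-suc j (g , gs , sg) = ((fromInj j ∘ g) ⁂ id) , IsInverse-resp (state-suc j)
      ( (⁂id∘ ■ ⁂id-cong (inverse-∘ gs (proj₁ (toInj-inverse j))) ■ id⁂id)
      , (⁂id∘ ■ ⁂id-cong (inverse-∘ (proj₂ (toInj-inverse j)) sg) ■ id⁂id) )

  unfoldⁿ : ℕ → Elem → Elem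
  unfoldⁿ zero    x = x
  unfoldⁿ (suc k) x = unfold (unfoldⁿ k x)

  unfoldⁿ~ : ∀ k x → unfoldⁿ k x ~ x
  unfoldⁿ~ zero    x = ε
  unfoldⁿ~ (suc k) x = unfold~ (unfoldⁿ k x) ◅◅ unfoldⁿ~ k x

  unfoldⁿ-iso : ∀ k x i → toℕ i < k → StateIso (unfoldⁿ k x) i
  unfoldⁿ-iso (suc k) x zero    _        = Unfold.iso-zero (unfoldⁿ k x)
  unfoldⁿ-iso (suc k) x (suc j) (s≤s lt) = Unfold.iso-suc (unfoldⁿ k x) j
    (unfoldⁿ-iso k x (inject₁ j) (≡.subst (_< k) (≡.sym (toℕ-inject₁ j)) lt))

  -- A comb all of whose states are invertible is equivalent to the
  -- canonical comb of its outputs: the states form a chain isomorphism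
  -- History → M, and one dinaturality step along it does the job.
  module AllStatesIso (M : Chain) (G : Comps M M) (iso : ∀ i → StateIso (M , G) i) where
    open Run M G

    inv : ∀ p → extP M p ⇒ extP History p
    inv zero    = id
    inv (suc q) = proj₁ (iso q)

    inv-inverse : ∀ p → IsInverse (extPH state p) (inv p)
    inv-inverse zero    = identityˡ , identityˡ
    inv-inverse (suc q) = proj₂ (iso q)

    input-append : ∀ i → input i ∘ append i ≈ extPH state (inject₁ i) ⁂ id
    input-append zero    = ⟨!,id⟩∘π₂ ■ ≈sym id⁂id
    input-append (suc j) = ⁂id∘
      ■ ⁂id-cong (assoc ■ reflˡ (proj₂ (toInj-inverse j)) ■ identityʳ)

    transported : Comps M History
    transported i = ⟨ append i ∘ (inv (inject₁ i) ⁂ id) , π₂ ∘ G i ⟩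

    canonical-side : ∀ i → proj₂ (canonical (outputs (M , G))) i
                           ≈ transported i ∘ (extPH state (inject₁ i) ⁂ id)
    canonical-side i = ≈sym (⟨⟩∘ ■ ⟨⟩-cong
      (cancel⁂id (proj₁ (inv-inverse (inject₁ i))))
      (reflˡ (≈sym (input-append i)) ■ sassoc ■ reflʳ assoc))

    state-append : ∀ i → state i ∘ (append i ∘ (inv (inject₁ i) ⁂ id)) ≈ π₁ ∘ G i
    state-append i = reflʳ (state-eq i) ■ assoc ■ reflˡ (assoc ■ reflˡ (sassoc
      ■ reflʳ (input-append i) ■ ⁂id∘ ■ ⁂id-cong (proj₂ (inv-inverse (inject₁ i)))
      ■ id⁂id) ■ identityʳ)

    comb-side : ∀ i → (state i ⁂ id) ∘ transported i ≈ G i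
    comb-side i = ⁂∘⟨⟩ ■ ⟨⟩-cong (state-append i) identityˡ ■ η

    canonical~ : canonical (outputs (M , G)) ~ (M , G)
    canonical~ = dinat≈ state transported canonical-side comb-side

  canonical-outputs : ∀ x → canonical (outputs x) ~ x
  canonical-outputs x =
    canonical-cong (outputs-cong (~-sym (unfoldⁿ~ (suc n) x)))
    ◅◅ AllStatesIso.canonical~ _ _ (λ i → unfoldⁿ-iso (suc n) x i (toℕ<n i))
    ◅◅ unfoldⁿ~ (suc n) x

  comb⁺≅prod : Inverse (Comb⁺ n) (Prod n)
  comb⁺≅prod = record
    { to = outputs ; from = canonical
    ; to-cong = outputs-cong ; from-cong = canonical-cong
    ; inverse = strictlyInverseˡ⇒inverseˡ (Comb⁺ n) (Prod n) outputs-cong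
                  (λ p → RunCanonical.outputs-canonical p)
              , strictlyInverseʳ⇒inverseʳ (Comb⁺ n) (Prod n) canonical-cong
                  canonical-outputs }

-- Comb⁺ₙ ≅ Combₙ: an element of Combₙ is an element of Comb⁺ₙ whose last
-- object is 1, and conversely the last object of an element of Comb⁺ₙ can
-- be collapsed to 1 along the unique map Mₙ → 1.
module Collapse {o ℓ e} (CC : CartesianCategory o ℓ e)
                (X Y : ℕ → CartesianCategory.Obj CC) where
  open CartesianReasoning CC
  open Combs CC X Y

  -- The chain map M → snoc1 (M ∘ inject₁): identities, then Mₙ → 1.
  collapse : ∀ {n} (M : Fin (suc n) → Obj) q → M q ⇒ snoc1 (λ j → M (inject₁ j)) q
  collapse {zero}  M zero    = !
  collapse {suc n} M zero    = id
  collapse {suc n} M (suc q) = collapse (λ j → M (suc j)) q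

  -- Away from the last position the collapse is an identity; this is its
  -- inverse there.
  uncollapse : ∀ {n} (M : Fin (suc n) → Obj) (j : Fin n) →
               snoc1 (λ j → M (inject₁ j)) (inject₁ j) ⇒ M (inject₁ j)
  uncollapse {suc n} M zero    = id
  uncollapse {suc n} M (suc j) = uncollapse (λ j → M (suc j)) j

  uncollapse∘collapse : ∀ {n} (M : Fin (suc n) → Obj) (j : Fin n) →
                        uncollapse M j ∘ collapse M (inject₁ j) ≈ id
  uncollapse∘collapse {suc n} M zero    = identityˡ
  uncollapse∘collapse {suc n} M (suc j) = uncollapse∘collapse (λ j → M (suc j)) j

  collapse-natural : ∀ {n} {M N : Fin (suc n) → Obj} (h : ∀ q → M q ⇒ N q) q →
                     snoc1H (λ j → h (inject₁ j)) q ∘ collapse M q ≈ collapse N q ∘ h q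
  collapse-natural {zero}  h zero    = !-uniq _ _
  collapse-natural {suc n} h zero    = identityʳ ■ ≈sym identityˡ
  collapse-natural {suc n} h (suc q) = collapse-natural (λ j → h (suc j)) q

  uncollapse-natural : ∀ {n} {M N : Fin (suc n) → Obj} (h : ∀ q → M q ⇒ N q) (j : Fin n) →
    h (inject₁ j) ∘ uncollapse M j
      ≈ uncollapse N j ∘ snoc1H (λ j → h (inject₁ j)) (inject₁ j)
  uncollapse-natural {suc n} h zero    = identityʳ ■ ≈sym identityˡ
  uncollapse-natural {suc n} h (suc j) = uncollapse-natural (λ j → h (suc j)) j

  snoc1-inject₁ : ∀ {n} (M : Fin n → Obj) j → M j ⇒ snoc1 M (inject₁ j)
  snoc1-inject₁ {suc n} M zero    = id
  snoc1-inject₁ {suc n} M (suc j) = snoc1-inject₁ (λ j → M (suc j)) j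

  snoc1H-inject₁ : ∀ {n} (M : Fin n → Obj) q →
                   snoc1H (snoc1-inject₁ M) q ≈ collapse (snoc1 M) q
  snoc1H-inject₁ {zero}  M zero    = !-uniq _ _
  snoc1H-inject₁ {suc n} M zero    = ≈refl
  snoc1H-inject₁ {suc n} M (suc q) = snoc1H-inject₁ (λ j → M (suc j)) q

  module _ (n : ℕ) where
    module C = CoendFacts CC X Y n n extC extCH
    module P = CoendFacts CC X Y n (suc n) extP extPH

    embedComps : ∀ {M N : Fin n → Obj} → C.Comps M N → P.Comps (snoc1 M) (snoc1 N)
    embedComps G zero    = G zero
    embedComps G (suc i) = G (suc i)

    embed : C.Elem → P.Elem
    embed (M , G) = snoc1 M , embedComps G

    embed-step : ∀ {x y} → C.Step x y → embed x P.~ embed y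
    embed-step (C.≈-step p) =
      P.≈-elem (λ { zero → p zero ; (suc i) → p (suc i) })
    embed-step (C.dinat h f) = P.dinat≈ (snoc1H h) (embedComps f)
      (λ { zero → ≈refl ; (suc i) → ≈refl }) (λ { zero → ≈refl ; (suc i) → ≈refl })

    embed-cong : ∀ {x y} → x C.~ y → embed x P.~ embed y
    embed-cong = EqClosure.gfold (Setoid.isEquivalence (Comb⁺ n)) embed embed-step

    -- Inverse of the collapse at the input positions, typed for Combₙ and
    -- for the embedding of Combₙ respectively.
    uncollapseC : (M : Fin (suc n) → Obj) → ∀ i →
                  extC (λ j → M (inject₁ j)) (inject₁ i) ⇒ extP M (inject₁ i)
    uncollapseC M zero    = id
    uncollapseC M (suc j) = uncollapse M j

    uncollapseP : (M : Fin (suc n) → Obj) → ∀ i →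
                  extP (snoc1 (λ j → M (inject₁ j))) (inject₁ i) ⇒ extP M (inject₁ i)
    uncollapseP M zero    = id
    uncollapseP M (suc j) = uncollapse M j

    uncollapseC-natural : ∀ {M N : Fin (suc n) → Obj} (h : ∀ q → M q ⇒ N q) i →
      extPH h (inject₁ i) ∘ uncollapseC M i
        ≈ uncollapseC N i ∘ extCH (λ j → h (inject₁ j)) (inject₁ i)
    uncollapseC-natural h zero    = ≈refl
    uncollapseC-natural h (suc j) = uncollapse-natural h j

    uncollapseP∘collapse : (M : Fin (suc n) → Obj) → ∀ i →
                           uncollapseP M i ∘ extPH (collapse M) (inject₁ i) ≈ id
    uncollapseP∘collapse M zero    = identityˡ
    uncollapseP∘collapse M (suc j) = uncollapse∘collapse M j

    conjugate : (M : Fin (suc n) → Obj) → P.Comps M M →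
                C.Comps (λ j → M (inject₁ j)) (λ j → M (inject₁ j))
    conjugate M G i = (collapse M i ⁂ id) ∘ G i ∘ (uncollapseC M i ⁂ id)

    restrict : P.Elem → C.Elem
    restrict (M , G) = (λ j → M (inject₁ j)) , conjugate M G

    restrict-step : ∀ {x y} → P.Step x y → restrict x C.~ restrict y
    restrict-step (P.≈-step p) = C.≈-elem (λ i → reflˡ (reflʳ (p i)))
    restrict-step (P.dinat {M} {N} h f) =
      C.dinat≈ (λ j → h (inject₁ j)) f-conj source target
      where
        f-conj : C.Comps (λ j → N (inject₁ j)) (λ j → M (inject₁ j))
        f-conj i = (collapse M i ⁂ id) ∘ f i ∘ (uncollapseC N i ⁂ id)
        source : ∀ i → conjugate M (λ i → f i ∘ (extPH h (inject₁ i) ⁂ id)) i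
                       ≈ f-conj i ∘ (extCH (λ j → h (inject₁ j)) (inject₁ i) ⁂ id)
        source i = reflˡ assoc
          ■ reflˡ (reflˡ (⁂id∘ ■ ⁂id-cong (uncollapseC-natural h i) ■ ≈sym ⁂id∘))
          ■ reflˡ sassoc ■ sassoc
        target : ∀ i → (extCH (λ j → h (inject₁ j)) (suc i) ⁂ id) ∘ f-conj i
                       ≈ conjugate N (λ i → (h i ⁂ id) ∘ f i) i
        target i = sassoc ■ reflʳ (⁂id∘ ■ ⁂id-cong (collapse-natural h i) ■ ≈sym ⁂id∘)
          ■ assoc ■ reflˡ sassoc

    restrict-cong : ∀ {x y} → x P.~ y → restrict x C.~ restrict y
    restrict-cong = EqClosure.gfold (Setoid.isEquivalence (Comb n)) restrict restrict-step

    -- Collapsing the last object is a dinaturality step.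
    embed-restrict : ∀ x → embed (restrict x) P.~ x
    embed-restrict (M , G) = P.~-sym (P.dinat≈ (collapse M)
      (λ i → G i ∘ (uncollapseP M i ⁂ id))
      (λ i → ≈sym (cancel⁂id (uncollapseP∘collapse M i)))
      (λ { zero → ≈refl ; (suc i) → ≈refl }))

    -- For a chain already ending in 1, collapsing changes nothing.
    restrict-embed : ∀ x → restrict (embed x) C.~ x
    restrict-embed (M , G) = C.~-sym (C.dinat≈ (snoc1-inject₁ M) f source target)
      where
        f : C.Comps (λ j → snoc1 M (inject₁ j)) M
        f i = embedComps G i ∘ (uncollapseC (snoc1 M) i ⁂ id)
        source : ∀ i → G i ≈ f i ∘ (extCH (snoc1-inject₁ M) (inject₁ i) ⁂ id)
        source zero    = ≈sym (cancel⁂id identityˡ)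
        source (suc j) = ≈sym (cancel⁂id (reflˡ (snoc1H-inject₁ M (inject₁ j))
                                          ■ uncollapse∘collapse (snoc1 M) j))
        target : ∀ i → (extCH (snoc1-inject₁ M) (suc i) ⁂ id) ∘ f i
                       ≈ conjugate (snoc1 M) (embedComps G) i
        target i = reflʳ (⁂id-cong (snoc1H-inject₁ M i))

    comb⁺≅comb : Inverse (Comb⁺ n) (Comb n)
    comb⁺≅comb = record
      { to = restrict ; from = embed
      ; to-cong = restrict-cong ; from-cong = embed-cong
      ; inverse = strictlyInverseˡ⇒inverseˡ (Comb⁺ n) (Comb n) restrict-cong restrict-embed
                , strictlyInverseʳ⇒inverseʳ (Comb⁺ n) (Comb n) embed-cong embed-restrict }

-- Imported only here: inside the development _×_ is the categorical product.
open import Data.Product using (_×_)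

mainTheorem3 : ∀ {o ℓ e} (CC : CartesianCategory o ℓ e)
                 (X Y : ℕ → CartesianCategory.Obj CC) (n : ℕ) →
                 Inverse (Combs.Comb⁺ CC X Y n) (Combs.Comb CC X Y n)
                 × Inverse (Combs.Comb CC X Y n) (Combs.Prod CC X Y n)
mainTheorem3 CC X Y n =
  comb⁺≅comb , Composition.inverse (Symmetry.inverse comb⁺≅comb) comb⁺≅prod
  where
    comb⁺≅comb : Inverse (Combs.Comb⁺ CC X Y n) (Combs.Comb CC X Y n)
    comb⁺≅comb = Collapse.comb⁺≅comb CC X Y n

    comb⁺≅prod : Inverse (Combs.Comb⁺ CC X Y n) (Combs.Prod CC X Y n)
    comb⁺≅prod = Outputs.comb⁺≅prod CC X Y n
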